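{- Fix an even integer $t\ge 4$. For every integer $d\ge 2$ with $d\equiv 0 \pmod{2(t-2)}$, there exists a $d$-regular bipartite graph $G$ with $\chi'_t(G)\ge \dfrac{d^t}{e\,t\,2^{t-1}}$.
   Context: Graphs are finite and simple. The line graph $L(G)$ of $G=(V,E)$ has vertex set $E$, two distinct edges being adjacent if they share an endpoint. For a graph $F$, $F^t$ is the graph on $V(F)$ in which two distinct vertices are adjacent if they are joined by a path in $F$ of length at most $t$. The distance-$t$ chromatic index is $\chi'_t(G)=\chi((L(G))^t)$. Here $e$ is Euler's number. -}

module Defs where

open import Data.Nat using (ℕ; zero; suc; _+_; _*_; _∸_; _^_; _≤_; _<_; _!)
open import Data.Nat.Divisibility using (_∣_)
open import Data.Fin as F using (Fin)
open import Data.Bool using (Bool; true; false; if_then_else_)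
open import Data.List using (List; map; allFin)
open import Data.Nat.ListAction using (sum)
open import Data.Product using (Σ; ∃; _×_; _,_)
open import Data.Sum using (_⊎_)
open import Relation.Binary.PropositionalEquality using (_≡_; _≢_)
open import Relation.Nullary using (¬_)

record Graph (n : ℕ) : Set where
  field
    adj   : Fin n → Fin n → Bool
    sym   : ∀ u v → adj u v ≡ adj v u
    irref : ∀ u → adj u u ≡ false
open Graph public

Adj : ∀ {n} → Graph n → Fin n → Fin n → Set
Adj G u v = adj G u v ≡ true

degree : ∀ {n} → Graph n → Fin n → ℕ
degree {n} G u = sum (map (λ v → if adj G u v then 1 else 0) (allFin n))

Regular : ∀ {n} → Graph n → ℕ → Set
Regular {n} G d = ∀ (u : Fin n) → degree G u ≡ d

Bipartite : ∀ {n} → Graph n → Set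
Bipartite {n} G = Σ (Fin n → Bool) λ side → ∀ u v → Adj G u v → side u ≢ side v

-- Edges of G: the edge {u,v} is represented by the ordered pair (u , v) with u < v.
IsEdge : ∀ {n} → Graph n → Fin n → Fin n → Set
IsEdge G u v = (u F.< v) × Adj G u v

LAdj : ∀ {n} → Graph n → Fin n × Fin n → Fin n × Fin n → Set
LAdj G (u , v) (u' , v') =
  IsEdge G u v × IsEdge G u' v' × ((u , v) ≢ (u' , v')) ×
  (u ≡ u' ⊎ u ≡ v' ⊎ v ≡ u' ⊎ v ≡ v')

data LWalk {n} (G : Graph n) : ℕ → Fin n × Fin n → Fin n × Fin n → Set where
  here : ∀ {x} → LWalk G zero x x
  step : ∀ {m x y z} → LAdj G x y → LWalk G m y z → LWalk G (suc m) x z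

-- Adjacency in (L(G))^t: distinct edges joined by a walk (equivalently a
-- path) in L(G) of length at most t.
LPowAdj : ∀ {n} → Graph n → ℕ → Fin n × Fin n → Fin n × Fin n → Set
LPowAdj G t x y = IsEdgeP x × IsEdgeP y × (x ≢ y) × Σ ℕ λ m → m ≤ t × LWalk G m x y
  where
  IsEdgeP : _ → Set
  IsEdgeP (u , v) = IsEdge G u v

-- A proper colouring of (L(G))^t with k colours (colours assigned to pairs;
-- only the values on edges matter).
ProperDistColouring : ∀ {n} → Graph n → ℕ → (k : ℕ) → (Fin n × Fin n → Fin k) → Set
ProperDistColouring G t k c = ∀ x y → LPowAdj G t x y → c x ≢ c y

-- eNum m = Σ_{j=0}^{m} m!/j!, so that eNum m / m! is the m-th partial sum of
-- e = Σ 1/j!.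
eNum : ℕ → ℕ
eNum zero    = 1
eNum (suc m) = suc m * eNum m + 1

-- N ≤ e·M  (for naturals N, M).  Since e is irrational and the partial sums
-- increase strictly to e, for N > 0 this holds iff some partial sum s_m
-- satisfies N < s_m · M, i.e. N · m! < M · eNum m.
_≤e*_ : ℕ → ℕ → Set
N ≤e* M = N ≡ 0 ⊎ Σ ℕ λ m → N * (m !) < M * eNum m

-- χ'_t(G) ≥ d^t / (e t 2^{t-1}), i.e. every proper colouring of (L(G))^t
-- with k colours has d^t ≤ e · k · t · 2^{t-1}.
ChiDistLowerBound : ∀ {n} → Graph n → (t d : ℕ) → Set
ChiDistLowerBound G t d =
  ∀ (k : ℕ) (c : _ → Fin k) → ProperDistColouring G t k c →
  (d ^ t) ≤e* (k * t * 2 ^ (t ∸ 1))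

-- Write d = 2q and m = t − 1, which is odd. On ℤ/4 × [q]^m join (s, x) to
-- (s + 1, x shifted left with a letter appended), for each of the q letters: every
-- vertex gets q forward and q backward neighbours, all distinct because s + 1 ≠ s − 1
-- in ℤ/4, so the graph is 2q-regular, and it is bipartite by the parity of s.
-- A forward walk of length m spells out an arbitrary word of length m, so from any
-- vertex in state 0 every vertex in state m is reached in m steps. Hence the q^t edges
-- joining state 0 to state m (a neighbouring state, as m is odd) are pairwise at
-- distance at most t in L(G): they form a clique in L(G)^t, and
-- χ'_t(G) ≥ q^t = (d/2)^t, which beats d^t / (e t 2^(t−1)) because e t ≥ 2.
module Submission where

open import Defs
open import Data.Nat using (ℕ; _*_; _∸_; _≤_)
open import Data.Nat.Divisibility using (_∣_)
open import Data.Product using (Σ; _×_)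

open import Data.Bool using (Bool; true; false; if_then_else_)
open import Data.Fin using (Fin; zero; suc; _<_)
open import Data.Fin.Patterns using (0F; 1F; 2F; 3F)
open import Data.Fin.Properties using (_≟_; any?; <-cmp; injective⇒≤; *↔×; combine-monoˡ-<)
open import Data.List as List using (List)
import Data.List.Properties as List
open import Data.Nat using (zero; suc; _+_; _^_; z≤n; s≤s; z<s; NonZero; >-nonZero)
open import Data.Nat.Divisibility using (divides; ∣-trans; m∣m*n)
open import Data.Nat.ListAction using () renaming (sum to sumˡ)
import Data.Nat.Properties as ℕ
open import Algebra.Properties.CommutativeMonoid.Sum ℕ.+-0-commutativeMonoid
  using (sum; sum-syntax; ∑-comm; sum-cong-≗; sum-replicate-zero)
open import Data.Nat.Tactic.RingSolver using (solve-∀)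
open import Data.Product using (∃; _,_; proj₁; proj₂; uncurry)
open import Data.Product.Function.NonDependent.Propositional using (_×-↔_)
open import Data.Product.Properties using (≡-dec)
open import Data.Sum using (_⊎_; inj₁; inj₂)
open import Data.Vec using (Vec; []; _∷_; _∷ʳ_; head; tail; init; last; initLast; toList; uncons)
open import Data.Vec.Properties
  using (init-∷ʳ; ∷ʳ-injectiveʳ; ∷-injectiveˡ; toList-∷ʳ; length-toList; toList-injective; cast-is-id)
open import Function using (Injective; _∘_)
open import Function.Bundles using (Inverse; _↔_; mk↔ₛ′; mk⇔; Injection)
open import Function.Construct.Composition using (_↔-∘_)
open import Function.Construct.Identity using (↔-id)
open import Function.Properties.Inverse using (↔-sym; ↔⇒↣)
open import Relation.Binary using (tri<; tri≈; tri>)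
open import Relation.Binary.PropositionalEquality as ≡
  using (_≡_; _≢_; refl; cong; cong₂; trans; subst; module ≡-Reasoning)
open import Relation.Nullary using (Dec; does; yes; no; contradiction)
open import Relation.Nullary.Decidable using (dec-true; dec-false; does-⇔; decidable-stable)

sumˡ-tabulate : ∀ {n} (f : Fin n → ℕ) → sumˡ (List.tabulate f) ≡ sum f
sumˡ-tabulate {zero}  f = refl
sumˡ-tabulate {suc n} f = cong (f zero +_) (sumˡ-tabulate (f ∘ suc))

sumˡ-allFin : ∀ {n} (f : Fin n → ℕ) → sumˡ (List.map f (List.allFin n)) ≡ sum f
sumˡ-allFin f = trans (cong sumˡ (List.map-tabulate (λ i → i) f)) (sumˡ-tabulate f)

indicator : Bool → ℕ
indicator b = if b then 1 else 0

δ : ∀ {n} → Fin n → Fin n → ℕ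
δ i j = indicator (does (i ≟ j))

∑-δ : ∀ {n} (i : Fin n) → ∑[ j < n ] δ i j ≡ 1
∑-δ {suc n} zero    = cong suc (sum-replicate-zero n)
∑-δ {suc n} (suc i) = ∑-δ i

∑-1 : ∀ n → ∑[ _ < n ] 1 ≡ n
∑-1 zero    = refl
∑-1 (suc n) = cong suc (∑-1 n)

module _ {D N : ℕ} {f : Fin D → Fin N} (f-injective : Injective _≡_ _≡_ f) where

  image-indicator≡∑δ : ∀ j → indicator (does (any? λ k → f k ≟ j)) ≡ ∑[ k < D ] δ (f k) j
  image-indicator≡∑δ j with any? (λ k → f k ≟ j)
  ... | yes (k₀ , refl) = ≡.sym (trans (sum-cong-≗ λ k → cong indicator (f-unique k)) (∑-δ k₀))
    where
    f-unique : ∀ k → does (f k ≟ f k₀) ≡ does (k₀ ≟ k)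
    f-unique k = does-⇔ (mk⇔ (≡.sym ∘ f-injective) (cong f ∘ ≡.sym)) (f k ≟ f k₀) (k₀ ≟ k)
  ... | no ∉ = ≡.sym (trans (sum-cong-≗ λ k → cong indicator (dec-false (f k ≟ j) (∉ ∘ (k ,_))))
                            (sum-replicate-zero D))

  ∑-image-indicator : ∑[ j < N ] indicator (does (any? λ k → f k ≟ j)) ≡ D
  ∑-image-indicator = begin
    ∑[ j < N ] indicator (does (any? λ k → f k ≟ j)) ≡⟨ sum-cong-≗ image-indicator≡∑δ ⟩
    ∑[ j < N ] ∑[ k < D ] δ (f k) j                  ≡⟨ ∑-comm (λ j k → δ (f k) j) ⟩
    ∑[ k < D ] ∑[ j < N ] δ (f k) j                  ≡⟨ sum-cong-≗ (∑-δ ∘ f) ⟩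
    ∑[ k < D ] 1                                     ≡⟨ ∑-1 D ⟩
    D                                                ∎
    where open ≡-Reasoning

module NeighbourGraph {V I : Set} {N D : ℕ} (vertices : Fin N ↔ V) (indices : Fin D ↔ I)
  (nbr : V → I → V)
  (nbr-injective : ∀ v → Injective _≡_ _≡_ (nbr v))
  (nbr-reverse : ∀ v i → ∃ λ j → nbr (nbr v i) j ≡ v)
  (nbr-loopless : ∀ v i → nbr v i ≢ v)
  where

  open Inverse vertices public using () renaming
    (to to decode; from to encode; strictlyInverseˡ to decode-encode; strictlyInverseʳ to encode-decode)
  open Inverse indices using () renaming (to to index; from to unindex; strictlyInverseˡ to index-unindex)

  encode-injective : Injective _≡_ _≡_ encode
  encode-injective = Injection.injective (↔⇒↣ (↔-sym vertices))

  neighbour : Fin N → Fin D → Fin N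
  neighbour u k = encode (nbr (decode u) (index k))

  neighbour-injective : ∀ u → Injective _≡_ _≡_ (neighbour u)
  neighbour-injective u =
    Injection.injective (↔⇒↣ indices) ∘ nbr-injective (decode u) ∘ encode-injective

  IsNeighbour : Fin N → Fin N → Set
  IsNeighbour u w = ∃ λ k → neighbour u k ≡ w

  isNeighbour? : ∀ u w → Dec (IsNeighbour u w)
  isNeighbour? u w = any? λ k → neighbour u k ≟ w

  encode-nbr-isNeighbour : ∀ v i → IsNeighbour (encode v) (encode (nbr v i))
  encode-nbr-isNeighbour v i =
    unindex i , cong₂ (λ v i → encode (nbr v i)) (decode-encode v) (index-unindex i)

  isNeighbour-sym : ∀ {u w} → IsNeighbour u w → IsNeighbour w u
  isNeighbour-sym {u} (k , refl) with nbr-reverse (decode u) (index k)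
  ... | j , back = subst (IsNeighbour _) (trans (cong encode back) (encode-decode u))
                         (encode-nbr-isNeighbour (nbr (decode u) (index k)) j)

  graph : Graph N
  graph = record
    { adj   = λ u w → does (isNeighbour? u w)
    ; sym   = λ u w → does-⇔ (mk⇔ isNeighbour-sym isNeighbour-sym) (isNeighbour? u w) (isNeighbour? w u)
    ; irref = λ u → dec-false (isNeighbour? u u) λ (k , loop) →
        nbr-loopless (decode u) (index k) (trans (≡.sym (decode-encode _)) (cong decode loop))
    }

  Adj⇒isNeighbour : ∀ {u w} → Adj graph u w → IsNeighbour u w
  Adj⇒isNeighbour {u} {w} uw with isNeighbour? u w
  ... | yes found = found
  Adj⇒isNeighbour () | no _

  nbr-adjacent : ∀ v i → Adj graph (encode v) (encode (nbr v i))
  nbr-adjacent v i = dec-true (isNeighbour? _ _) (encode-nbr-isNeighbour v i)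

  regular : Regular graph D
  regular u = trans (sumˡ-allFin (λ w → indicator (adj graph u w))) (∑-image-indicator (neighbour-injective u))

  bipartite : (side : V → Bool) → (∀ v i → side (nbr v i) ≢ side v) → Bipartite graph
  bipartite side flips = side ∘ decode , λ u w → side-flips ∘ Adj⇒isNeighbour
    where
    side-flips : ∀ {u w} → IsNeighbour u w → side (decode u) ≢ side (decode w)
    side-flips {u} (k , refl) same =
      flips (decode u) (index k) (trans (cong side (≡.sym (decode-encode _))) (≡.sym same))

module _ {n : ℕ} (G : Graph n) where

  infixr 5 _∷_

  data Walk : ℕ → Fin n → Fin n → Set where
    []  : ∀ {u} → Walk zero u u
    _∷_ : ∀ {m u v w} → Adj G u v → Walk m v w → Walk (suc m) u w

  Edge : Set
  Edge = Fin n × Fin n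

  IsEdgeᵖ : Edge → Set
  IsEdgeᵖ (u , v) = IsEdge G u v

  Endpoint : Edge → Fin n → Set
  Endpoint (u , v) w = w ≡ u ⊎ w ≡ v

  ShortLWalk : ℕ → Edge → Edge → Set
  ShortLWalk l x y = Σ ℕ λ l′ → l′ ≤ l × LWalk G l′ x y

  edgeBetween : ∀ {u v} → Adj G u v → Σ Edge λ e → IsEdgeᵖ e × Endpoint e u × Endpoint e v
  edgeBetween {u} {v} uv with <-cmp u v
  ... | tri< u<v _ _ = (u , v) , (u<v , uv) , inj₁ refl , inj₂ refl
  ... | tri≈ _ refl _ = contradiction (trans (≡.sym uv) (irref G u)) λ ()
  ... | tri> _ _ v<u = (v , u) , (v<u , trans (sym G v u) uv) , inj₂ refl , inj₁ refl

  sharedEndpoint⇒LAdj : ∀ {x y w} → IsEdgeᵖ x → IsEdgeᵖ y → x ≢ y →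
                        Endpoint x w → Endpoint y w → LAdj G x y
  sharedEndpoint⇒LAdj ex ey x≢y (inj₁ refl) (inj₁ refl) = ex , ey , x≢y , inj₁ refl
  sharedEndpoint⇒LAdj ex ey x≢y (inj₁ refl) (inj₂ refl) = ex , ey , x≢y , inj₂ (inj₁ refl)
  sharedEndpoint⇒LAdj ex ey x≢y (inj₂ refl) (inj₁ refl) = ex , ey , x≢y , inj₂ (inj₂ (inj₁ refl))
  sharedEndpoint⇒LAdj ex ey x≢y (inj₂ refl) (inj₂ refl) = ex , ey , x≢y , inj₂ (inj₂ (inj₂ refl))

  ShortLWalk-prepend : ∀ {l x y z w} → IsEdgeᵖ x → IsEdgeᵖ y → Endpoint x w → Endpoint y w →
                       ShortLWalk l y z → ShortLWalk (suc l) x z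
  ShortLWalk-prepend {x = x} {y} ex ey xw yw (l′ , l′≤l , walk) with ≡-dec _≟_ _≟_ x y
  ... | yes refl = l′ , ℕ.m≤n⇒m≤1+n l′≤l , walk
  ... | no x≢y   = suc l′ , s≤s l′≤l , step (sharedEndpoint⇒LAdj ex ey x≢y xw yw) walk

  walk⇒ShortLWalk : ∀ {m u v x y} → IsEdgeᵖ x → IsEdgeᵖ y → Endpoint x u → Endpoint y v →
                    Walk m u v → ShortLWalk (suc m) x y
  walk⇒ShortLWalk ex ey xu yv []          = ShortLWalk-prepend ex ey xu yv (zero , z≤n , here)
  walk⇒ShortLWalk ex ey xu yv (uv ∷ walk) with edgeBetween uv
  ... | e , ee , eu , ev = ShortLWalk-prepend ex ee xu eu (walk⇒ShortLWalk ee ey ev yv walk)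

  clique≤colours : ∀ {s t k} (e : Fin s → Edge) → (∀ i j → i ≢ j → LPowAdj G t (e i) (e j)) →
                   (c : Edge → Fin k) → ProperDistColouring G t k c → s ≤ k
  clique≤colours e clique c proper = injective⇒≤ λ {i} {j} same →
    decidable-stable (i ≟ j) λ i≢j → proper (e i) (e j) (clique i j i≢j) same

∷↔Vec : ∀ {A : Set} {n} → (A × Vec A n) ↔ Vec A (suc n)
∷↔Vec = mk↔ₛ′ (uncurry _∷_) uncons (λ { (_ ∷ _) → refl }) (λ _ → refl)

^↔Vec : ∀ {q} m → Fin (q ^ m) ↔ Vec (Fin q) m
^↔Vec zero    = mk↔ₛ′ (λ _ → []) (λ _ → zero) (λ { [] → refl }) (λ { zero → refl })
^↔Vec (suc m) = ∷↔Vec ↔-∘ ((↔-id _ ×-↔ ^↔Vec m) ↔-∘ *↔×)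

drop-++ : ∀ {A : Set} (xs : List A) {ys} → List.drop (List.length xs) (xs List.++ ys) ≡ ys
drop-++ List.[]       = refl
drop-++ (_ List.∷ xs) = drop-++ xs

module _ {A : Set} {n : ℕ} where

  shiftˡ : Vec A (suc n) → A → Vec A (suc n)
  shiftˡ x c = tail x ∷ʳ c

  shiftʳ : Vec A (suc n) → A → Vec A (suc n)
  shiftʳ x c = c ∷ init x

  shiftʳ-shiftˡ : ∀ x c → shiftʳ (shiftˡ x c) (head x) ≡ x
  shiftʳ-shiftˡ (a ∷ x) c = cong (a ∷_) (init-∷ʳ c x)

  shiftˡ-shiftʳ : ∀ x c → shiftˡ (shiftʳ x c) (last x) ≡ x
  shiftˡ-shiftʳ x c = ≡.sym (proj₂ (proj₂ (initLast x)))

  shiftˡ-injectiveʳ : ∀ x {c c′} → shiftˡ x c ≡ shiftˡ x c′ → c ≡ c′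
  shiftˡ-injectiveʳ x = ∷ʳ-injectiveʳ (tail x) (tail x)

  shiftʳ-injectiveʳ : ∀ x {c c′} → shiftʳ x c ≡ shiftʳ x c′ → c ≡ c′
  shiftʳ-injectiveʳ x = ∷-injectiveˡ

  shiftInˡ : ∀ {m} → Vec A (suc n) → Vec A m → Vec A (suc n)
  shiftInˡ x []      = x
  shiftInˡ x (c ∷ z) = shiftInˡ (shiftˡ x c) z

  toList-shiftInˡ : ∀ {m} (x : Vec A (suc n)) (z : Vec A m) →
                    toList (shiftInˡ x z) ≡ List.drop m (toList x List.++ toList z)
  toList-shiftInˡ x [] = ≡.sym (List.++-identityʳ (toList x))
  toList-shiftInˡ {suc m} (a ∷ x) (c ∷ z) = begin
    toList (shiftInˡ (x ∷ʳ c) z)                           ≡⟨ toList-shiftInˡ (x ∷ʳ c) z ⟩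
    List.drop m (toList (x ∷ʳ c) List.++ toList z)         ≡⟨ cong (λ l → List.drop m (l List.++ toList z))
                                                                   (toList-∷ʳ c x) ⟩
    List.drop m ((toList x List.++ List.[ c ]) List.++ toList z) ≡⟨ cong (List.drop m)
                                                                   (List.++-assoc (toList x) _ _) ⟩
    List.drop m (toList x List.++ c List.∷ toList z)       ∎
    where open ≡-Reasoning

  shiftInˡ-full : ∀ (x z : Vec A (suc n)) → shiftInˡ x z ≡ z
  shiftInˡ-full x z = trans (≡.sym (cast-is-id refl (shiftInˡ x z))) (toList-injective refl _ _ (begin
    toList (shiftInˡ x z)                                 ≡⟨ toList-shiftInˡ x z ⟩
    List.drop (suc n) (toList x List.++ toList z)         ≡⟨ cong (λ m → List.drop m (toList x List.++ toList z))
                                                                (≡.sym (length-toList x)) ⟩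
    List.drop (List.length (toList x)) (toList x List.++ toList z) ≡⟨ drop-++ (toList x) ⟩
    toList z                                              ∎))
    where open ≡-Reasoning

pattern forward  = 0F
pattern backward = 1F

next prev : Fin 4 → Fin 4
next 0F = 1F
next 1F = 2F
next 2F = 3F
next 3F = 0F
prev 0F = 3F
prev 1F = 0F
prev 2F = 1F
prev 3F = 2F

move : Fin 2 → Fin 4 → Fin 4
move forward  = next
move backward = prev

even : Fin 4 → Bool
even 0F = true
even 1F = false
even 2F = true
even 3F = false

prev-next : ∀ s → prev (next s) ≡ s
prev-next 0F = refl
prev-next 1F = refl
prev-next 2F = refl
prev-next 3F = refl

next-prev : ∀ s → next (prev s) ≡ s
next-prev 0F = refl
next-prev 1F = refl
next-prev 2F = refl
next-prev 3F = refl

next³≡prev : ∀ s → next (next (next s)) ≡ prev s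
next³≡prev 0F = refl
next³≡prev 1F = refl
next³≡prev 2F = refl
next³≡prev 3F = refl

next≢prev : ∀ s → next s ≢ prev s
next≢prev 0F ()
next≢prev 1F ()
next≢prev 2F ()
next≢prev 3F ()

even-move : ∀ d s → even (move d s) ≢ even s
even-move forward  0F ()
even-move forward  1F ()
even-move forward  2F ()
even-move forward  3F ()
even-move backward 0F ()
even-move backward 1F ()
even-move backward 2F ()
even-move backward 3F ()

nextⁿ : ℕ → Fin 4 → Fin 4
nextⁿ zero    s = s
nextⁿ (suc j) s = nextⁿ j (next s)

nextⁿ-odd : ∀ k s → ∃ λ d → nextⁿ (suc (k * 2)) s ≡ move d s
nextⁿ-odd zero    s = forward , refl
nextⁿ-odd (suc k) s with nextⁿ-odd k (next (next s))
... | forward  , reached = backward , trans reached (next³≡prev s)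
... | backward , reached = forward  , trans reached (prev-next (next s))

module ShiftGraph (q r : ℕ) where

  Word : Set
  Word = Vec (Fin q) (suc r)

  Vertex : Set
  Vertex = Fin 4 × Word

  shift : Fin 2 → Word → Fin q → Word
  shift forward  = shiftˡ
  shift backward = shiftʳ

  nbr : Vertex → Fin q × Fin 2 → Vertex
  nbr (s , x) (c , d) = move d s , shift d x c

  nbr-injective : ∀ v → Injective _≡_ _≡_ (nbr v)
  nbr-injective (s , x) {_ , forward}  {_ , forward}  same =
    cong (_, forward) (shiftˡ-injectiveʳ x (cong proj₂ same))
  nbr-injective (s , x) {_ , forward}  {_ , backward} same = contradiction (cong proj₁ same) (next≢prev s)
  nbr-injective (s , x) {_ , backward} {_ , forward}  same = contradiction (cong proj₁ (≡.sym same)) (next≢prev s)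
  nbr-injective (s , x) {_ , backward} {_ , backward} same =
    cong (_, backward) (shiftʳ-injectiveʳ x (cong proj₂ same))

  nbr-reverse : ∀ v i → ∃ λ j → nbr (nbr v i) j ≡ v
  nbr-reverse (s , x) (c , forward)  = (head x , backward) , cong₂ _,_ (prev-next s) (shiftʳ-shiftˡ x c)
  nbr-reverse (s , x) (c , backward) = (last x , forward)  , cong₂ _,_ (next-prev s) (shiftˡ-shiftʳ x c)

  nbr-loopless : ∀ v i → nbr v i ≢ v
  nbr-loopless (s , x) (c , d) = even-move d s ∘ cong (even ∘ proj₁)

  vertices : Fin (4 * q ^ suc r) ↔ Vertex
  vertices = (↔-id (Fin 4) ×-↔ ^↔Vec (suc r)) ↔-∘ *↔×

  open NeighbourGraph vertices *↔× nbr nbr-injective nbr-reverse nbr-loopless public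

  bipartite-by-parity : Bipartite graph
  bipartite-by-parity = bipartite (even ∘ proj₁) λ (s , _) (_ , d) → even-move d s

  forwardWalk : ∀ {j} s x (z : Vec (Fin q) j) →
                Walk graph j (encode (s , x)) (encode (nextⁿ j s , shiftInˡ x z))
  forwardWalk s x []      = []
  forwardWalk s x (c ∷ z) = nbr-adjacent (s , x) (c , forward) ∷ forwardWalk (next s) (shiftˡ x c) z

  -- The state is the leading digit of the encoding, so an edge leaving state 0 lists that end first.
  encode-0F<move : ∀ d x y → encode (0F , x) < encode (move d 0F , y)
  encode-0F<move forward  x y = combine-monoˡ-< {m = 4} {i = 0F} {j = 1F} (encodeWord x) (encodeWord y) z<s
    where encodeWord = Inverse.from (^↔Vec (suc r))
  encode-0F<move backward x y = combine-monoˡ-< {m = 4} {i = 0F} {j = 3F} (encodeWord x) (encodeWord y) z<s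
    where encodeWord = Inverse.from (^↔Vec (suc r))

  module Clique (d : Fin 2) (reached : nextⁿ (suc r) 0F ≡ move d 0F) where

    cliqueEdge : Vec (Fin q) (suc (suc r)) → Edge graph
    cliqueEdge (c ∷ x) = encode (0F , x) , encode (nbr (0F , x) (c , d))

    cliqueEdge-isEdge : ∀ w → IsEdgeᵖ graph (cliqueEdge w)
    cliqueEdge-isEdge (c ∷ x) = encode-0F<move d x (shift d x c) , nbr-adjacent (0F , x) (c , d)

    cliqueEdge-injective : Injective _≡_ _≡_ cliqueEdge
    cliqueEdge-injective {c ∷ x} {c′ ∷ x′} same with encode-injective {0F , x} {0F , x′} (cong proj₁ same)
    ... | refl = cong (_∷ x) (cong proj₁ (nbr-injective (0F , x) {c , d} {c′ , d}
                                                        (encode-injective (cong proj₂ same))))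

    -- Walk forward from the state-0 end of the first edge, spelling out the far end of the second.
    cliqueEdge-walk : ∀ w w′ → ShortLWalk graph (suc (suc r)) (cliqueEdge w) (cliqueEdge w′)
    cliqueEdge-walk (c ∷ x) (c′ ∷ x′) =
      walk⇒ShortLWalk graph (cliqueEdge-isEdge (c ∷ x)) (cliqueEdge-isEdge (c′ ∷ x′))
                      (inj₁ refl) (inj₂ refl)
        (subst (Walk graph (suc r) (encode (0F , x)) ∘ encode)
               (cong₂ _,_ reached (shiftInˡ-full x (shift d x′ c′)))
               (forwardWalk 0F x (shift d x′ c′)))

    clique-bound : ∀ k col → ProperDistColouring graph (suc (suc r)) k col → q ^ suc (suc r) ≤ k
    clique-bound k = clique≤colours graph (cliqueEdge ∘ Inverse.to words) λ i j i≢j →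
      cliqueEdge-isEdge _ , cliqueEdge-isEdge _ ,
      i≢j ∘ Injection.injective (↔⇒↣ words) ∘ cliqueEdge-injective ,
      cliqueEdge-walk _ _
      where words = ^↔Vec (suc (suc r))

*-^ : ∀ a b n → (a * b) ^ n ≡ a ^ n * b ^ n
*-^ a b zero    = refl
*-^ a b (suc n) = trans (cong (a * b *_) (*-^ a b n)) (interchange a b (a ^ n) (b ^ n))
  where
  interchange : ∀ a b x y → a * b * (x * y) ≡ a * x * (b * y)
  interchange = solve-∀

≤e*-bound : ∀ q s k → .{{NonZero q}} → 2 ≤ s → q ^ suc s ≤ k →
            ((q * 2) ^ suc s) ≤e* (k * suc s * 2 ^ s)
≤e*-bound q s k 2≤s q^t≤k = inj₂ (zero , (begin-strict
  (q * 2) ^ suc s * 1      ≡⟨ regroup ⟩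
  2 * (2 ^ s * q ^ suc s)  ≤⟨ ℕ.*-monoʳ-≤ 2 (ℕ.*-monoʳ-≤ (2 ^ s) q^t≤k) ⟩
  2 * (2 ^ s * k)          <⟨ ℕ.*-monoˡ-< (2 ^ s * k) (s≤s 2≤s) ⟩
  suc s * (2 ^ s * k)      ≡⟨ reorder (suc s) (2 ^ s) k ⟩
  k * suc s * 2 ^ s * 1    ∎))
  where
  open ℕ.≤-Reasoning
  k≢0 : NonZero k
  k≢0 = >-nonZero (ℕ.≤-trans (ℕ.m^n>0 q (suc s)) q^t≤k)
  instance
    2^s*k≢0 : NonZero (2 ^ s * k)
    2^s*k≢0 = ℕ.m*n≢0 (2 ^ s) k {{ℕ.m^n≢0 2 s}} {{k≢0}}
  arrange : ∀ x y → x * (2 * y) * 1 ≡ 2 * (y * x)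
  arrange = solve-∀
  regroup : (q * 2) ^ suc s * 1 ≡ 2 * (2 ^ s * q ^ suc s)
  regroup = trans (cong (_* 1) (*-^ q 2 (suc s))) (arrange (q ^ suc s) (2 ^ s))
  reorder : ∀ t p k → t * (p * k) ≡ k * t * p * 1
  reorder = solve-∀

proposition9 : (t : ℕ) → 4 ≤ t → 2 ∣ t →
    (d : ℕ) → 2 ≤ d → (2 * (t ∸ 2)) ∣ d →
    Σ ℕ λ n → Σ (Graph n) λ G → Regular G d × Bipartite G × ChiDistLowerBound G t d
proposition9 t 4≤t 2∣t d 2≤d 2[t∸2]∣d with 2∣t | ∣-trans (m∣m*n {2} (t ∸ 2)) 2[t∸2]∣d
... | divides 0 refl | _ = contradiction 4≤t λ ()
... | divides 1 refl | _ = contradiction 4≤t λ { (s≤s (s≤s ())) }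
... | divides (suc (suc k)) refl | divides 0 refl = contradiction 2≤d λ ()
... | divides (suc (suc k)) refl | divides (suc q) refl with nextⁿ-odd (suc k) 0F
... | direction , reached =
  _ , graph , regular , bipartite-by-parity ,
  λ colours col proper → ≤e*-bound (suc q) _ colours (s≤s (s≤s z≤n)) (clique-bound colours col proper)
  where
  open ShiftGraph (suc q) (suc k * 2)
  open Clique direction reached
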